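{- The polynomial ${\rm Det}_{\cal F}M$ is invariant under the action of the linear group on $M$ in the following sense: \[ {\rm Det}_{\cal F}(g.M)=\det g\;{\rm Det}_{\cal F}M, \] where, for an $n\times n$ matrix $g=(g_{ij})$, \[g.M=\left(\sum_{1\leq j_2 \leq n}g_{i_2j_2}M_{i_1,j_2,i_3,\dots,i_k}\right)_{1\leq i_1,\dots,i_k\leq n}.\]
   Context: Let $M=(M_{i_1,\dots,i_k})_{1\leq i_1,\dots,i_k\leq n}$ be a $k$th order hypermatrix (tensor) with entries in a commutative ring, and let $\mathfrak S_n$ denote the symmetric group on $\{1,\dots,n\}$. Let ${\cal F}$ be a map from $\mathfrak S_n^{k-2}$ to a commutative ring. The ${\cal F}$-determinant of $M$ is defined by \[{\rm Det}_{\cal F}(M)=\sum_{(\sigma_2,\dots,\sigma_k)\in\mathfrak S_n^{k-1}}\mathrm{sign}(\sigma_2)\,{\cal F}(\sigma_3,\dots,\sigma_k)\prod_{i=1}^n M_{i\,\sigma_2(i)\dots\sigma_k(i)}.\] -}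

module Defs where

open import Data.Nat using (ℕ; zero; suc)
open import Data.Fin using (Fin; zero; suc; _<?_; _≟_)
open import Data.Bool using (Bool; true; false; _∧_; _∨_; if_then_else_; not)
open import Data.Vec.Functional using (_∷_)
open import Relation.Nullary.Decidable using (⌊_⌋)
open import Algebra.Bundles using (CommutativeRing)
import Algebra.Definitions.RawMonoid as RM

allᵇ : ∀ {n} → (Fin n → Bool) → Bool
allᵇ {zero}  p = true
allᵇ {suc n} p = p zero ∧ allᵇ (λ i → p (suc i))

anyᵇ : ∀ {n} → (Fin n → Bool) → Bool
anyᵇ {zero}  p = false
anyᵇ {suc n} p = p zero ∨ anyᵇ (λ i → p (suc i))

isBijective : ∀ {n} → (Fin n → Fin n) → Bool
isBijective σ =
  allᵇ (λ i → allᵇ (λ j → not ⌊ σ i ≟ σ j ⌋ ∨ ⌊ i ≟ j ⌋))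
  ∧ allᵇ (λ y → anyᵇ (λ x → ⌊ σ x ≟ y ⌋))

allBijective : ∀ {m n} → (Fin m → Fin n → Fin n) → Bool
allBijective τ = allᵇ (λ l → isBijective (τ l))

module _ {c ℓ} (R : CommutativeRing c ℓ) where
  open CommutativeRing R
  open RM +-rawMonoid using (sum)
  open RM *-rawMonoid using () renaming (sum to prod)

  sumFun : ∀ {n} k → ((Fin k → Fin n) → Carrier) → Carrier
  sumFun zero    f = f (λ ())
  sumFun (suc k) f = sum (λ j → sumFun k (λ h → f (j ∷ h)))

  sumEndo : ∀ {n} → ((Fin n → Fin n) → Carrier) → Carrier
  sumEndo {n} = sumFun n

  sumTuples : ∀ {n} m → ((Fin m → Fin n → Fin n) → Carrier) → Carrier
  sumTuples zero    f = f (λ ())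
  sumTuples (suc m) f = sumEndo (λ σ → sumTuples m (λ τ → f (σ ∷ τ)))

  𝟙 : Bool → Carrier
  𝟙 b = if b then 1# else 0#

  sign : ∀ {n} → (Fin n → Fin n) → Carrier
  sign σ = prod (λ i → prod (λ j →
    if ⌊ i <? j ⌋ ∧ ⌊ σ j <? σ i ⌋ then - 1# else 1#))

  det : ∀ {n} → (Fin n → Fin n → Carrier) → Carrier
  det g = sumEndo (λ σ → 𝟙 (isBijective σ) * (sign σ * prod (λ i → g i (σ i))))

  -- hypermatrix of order k = m + 2 : entry M i₁ i₂ (i₃,…,iₖ)
  Hypermatrix : ℕ → ℕ → Set c
  Hypermatrix n m = Fin n → Fin n → (Fin m → Fin n) → Carrier

  -- Det_F M, where F : 𝔖ₙ^(k-2) → R is given on tuples (σ₃,…,σₖ)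
  -- (its values on non-bijective tuples are irrelevant: they get weight 0)
  DetF : ∀ {n m} → ((Fin m → Fin n → Fin n) → Carrier) → Hypermatrix n m → Carrier
  DetF {n} {m} F M = sumEndo (λ σ₂ → sumTuples m (λ τ →
    𝟙 (isBijective σ₂ ∧ allBijective τ)
      * (sign σ₂ * (F τ * prod (λ i → M i (σ₂ i) (λ l → τ l i))))))

  act : ∀ {n m} → (Fin n → Fin n → Carrier) → Hypermatrix n m → Hypermatrix n m
  act g M i₁ i₂ is = sum (λ j₂ → g i₂ j₂ * M i₁ j₂ is)

-- Fix the permutations τ = (σ₃,…,σₖ).  The terms of Det_F M belonging to τ add up to
-- F(τ) · det Mτ, where Mτ is the matrix (i, j) ↦ M i j (τ₃ i, …, τₖ i), and the same slice
-- of g.M is the matrix product Mτ gᵀ.  So the theorem reduces to det (A gᵀ) = det g · det A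
-- for the Leibniz determinant.  Expanding the product of sums gives
-- det (AB) = Σ_h (∏ᵢ A i (h i)) · det (rows h of B), and det (rows h of B) is 0 when h
-- repeats an index (transpositions pair off the terms) and sign h · det B when h is a
-- permutation.  This rests on multiplicativity of the sign, written as a product of ±1
-- over the pairs i < j.

module Submission where

open import Defs
open import Data.Nat using (ℕ; zero; suc)
open import Data.Fin using (Fin)
open import Algebra.Bundles using (CommutativeRing)

import Algebra.Definitions.RawMonoid as RawMonoid
import Algebra.Properties.CommutativeMonoid.Sum as CommutativeMonoidSum
import Algebra.Properties.CommutativeSemigroup as CommutativeSemigroupProperties
import Algebra.Properties.Ring as RingProperties
import Algebra.Properties.Semiring.Sum as SemiringSum
import Algebra.Solver.CommutativeMonoid as CommutativeMonoidSolver
open import Data.Bool using (Bool; true; false; _∧_; not; if_then_else_)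
import Data.Bool.Properties as Bool
open import Data.Fin as Fin using (zero; suc; _<?_; _≟_; punchOut)
import Data.Fin.Properties as Fin
open import Data.Fin.Permutation using (Permutation; permutation)
open import Data.Fin.Permutation.Components using (transpose)
import Data.Nat as ℕ
import Data.Nat.Properties as ℕ
open import Data.Product using (∃; ∃₂; _×_; _,_; proj₁; proj₂)
open import Data.Vec.Functional using (_∷_)
open import Function using (id; _∘_; StrictlySurjective)
open import Level using (_⊔_)
open import Relation.Binary.Core using (_Preserves_⟶_)
open import Relation.Binary.Definitions using (tri<; tri≈; tri>)
open import Relation.Binary.PropositionalEquality as ≡ using (_≡_; _≢_; _≗_)
import Relation.Binary.Reasoning.Setoid as SetoidReasoning
open import Relation.Nullary using (¬_; Dec; _because_; yes; no; contradiction)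
open import Relation.Nullary.Decidable using (⌊_⌋; _→-dec_)
open import Relation.Nullary.Reflects using (Reflects; ofʸ; ofⁿ; _×-reflects_; _→-reflects_)
import Relation.Nullary.Reflects as Reflects

allᵇ-reflects : ∀ {n p} {P : Fin n → Set p} {b : Fin n → Bool} →
  (∀ i → Reflects (P i) (b i)) → Reflects (∀ i → P i) (allᵇ b)
allᵇ-reflects {zero} r = ofʸ (λ ())
allᵇ-reflects {suc n} {b = b} r with b zero | r zero
... | false | ofⁿ ¬p₀ = ofⁿ (λ p → ¬p₀ (p zero))
... | true  | ofʸ p₀ with allᵇ (b ∘ suc) | allᵇ-reflects (r ∘ suc)
...   | true  | ofʸ p  = ofʸ λ { zero → p₀ ; (suc i) → p i }
...   | false | ofⁿ ¬p = ofⁿ (λ p → ¬p (p ∘ suc))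

anyᵇ-reflects : ∀ {n p} {P : Fin n → Set p} {b : Fin n → Bool} →
  (∀ i → Reflects (P i) (b i)) → Reflects (∃ P) (anyᵇ b)
anyᵇ-reflects {zero} r = ofⁿ (λ ())
anyᵇ-reflects {suc n} {b = b} r with b zero | r zero
... | true  | ofʸ p₀ = ofʸ (zero , p₀)
... | false | ofⁿ ¬p₀ with anyᵇ (b ∘ suc) | anyᵇ-reflects (r ∘ suc)
...   | true  | ofʸ (i , p) = ofʸ (suc i , p)
...   | false | ofⁿ ¬p = ofⁿ λ { (zero , p) → ¬p₀ p ; (suc i , p) → ¬p (i , p) }

⌊⌋-reflects : ∀ {a} {A : Set a} (a? : Dec A) → Reflects A ⌊ a? ⌋
⌊⌋-reflects (yes a) = ofʸ a
⌊⌋-reflects (no ¬a) = ofⁿ ¬a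

module _ {n : ℕ} where

  Injective : (Fin n → Fin n) → Set
  Injective σ = ∀ i j → σ i ≡ σ j → i ≡ j

  IsBijection : (Fin n → Fin n) → Set
  IsBijection σ = Injective σ × StrictlySurjective _≡_ σ

  isBijective-reflects : ∀ σ → Reflects (IsBijection σ) (isBijective σ)
  isBijective-reflects σ =
    allᵇ-reflects (λ i → allᵇ-reflects (λ j → ⌊⌋-reflects (σ i ≟ σ j) →-reflects ⌊⌋-reflects (i ≟ j)))
    ×-reflects allᵇ-reflects (λ y → anyᵇ-reflects (λ x → ⌊⌋-reflects (σ x ≟ y)))

  isBijection? : ∀ σ → Dec (IsBijection σ)
  isBijection? σ = isBijective σ because isBijective-reflects σ

  inverse : (Fin n → Fin n) → Fin n → Fin n
  inverse σ y with Fin.any? (λ x → σ x ≟ y)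
  ... | yes (x , _) = x
  ... | no _        = y

  inverse-section : ∀ {σ} → StrictlySurjective _≡_ σ → ∀ y → σ (inverse σ y) ≡ y
  inverse-section {σ} surj y with Fin.any? (λ x → σ x ≟ y)
  ... | yes (x , σx≡y) = σx≡y
  ... | no ∄x          = contradiction (surj y) ∄x

  inverse-retraction : ∀ {σ} → IsBijection σ → ∀ x → inverse σ (σ x) ≡ x
  inverse-retraction {σ} (inj , surj) x = inj _ _ (inverse-section surj (σ x))

  isBijection-fromInverse : ∀ {σ} τ → (∀ y → σ (τ y) ≡ y) → (∀ x → τ (σ x) ≡ x) →
    IsBijection σ
  isBijection-fromInverse {σ} τ στ τσ =
    (λ i j σi≡σj → ≡.trans (≡.sym (τσ i)) (≡.trans (≡.cong τ σi≡σj) (τσ j))) , (λ y → τ y , στ y)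

  inverse-isBijection : ∀ {σ} → IsBijection σ → IsBijection (inverse σ)
  inverse-isBijection {σ} b@(_ , surj) =
    isBijection-fromInverse σ (inverse-retraction b) (inverse-section surj)

  ∘-isBijection : ∀ {σ τ} → IsBijection σ → IsBijection τ → IsBijection (σ ∘ τ)
  ∘-isBijection {σ} {τ} bσ@(_ , sσ) bτ@(_ , sτ) = isBijection-fromInverse (inverse τ ∘ inverse σ)
    (λ y → ≡.trans (≡.cong σ (inverse-section sτ _)) (inverse-section sσ y))
    (λ x → ≡.trans (≡.cong (inverse τ) (inverse-retraction bσ _)) (inverse-retraction bτ x))

  isBijection-cong : ∀ {σ τ} → σ ≗ τ → IsBijection σ → IsBijection τ
  isBijection-cong {σ} σ≗τ b@(_ , surj) = isBijection-fromInverse (inverse σ)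
    (λ y → ≡.trans (≡.sym (σ≗τ _)) (inverse-section surj y))
    (λ x → ≡.trans (≡.cong (inverse σ) (≡.sym (σ≗τ x))) (inverse-retraction b x))

  inverse-cong : ∀ {σ τ} → IsBijection σ → σ ≗ τ → inverse σ ≗ inverse τ
  inverse-cong {σ} {τ} b@(inj , surj) σ≗τ y = inj _ _ (begin
    σ (inverse σ y) ≡⟨ inverse-section surj y ⟩
    y               ≡⟨ inverse-section (proj₂ (isBijection-cong σ≗τ b)) y ⟨
    τ (inverse τ y) ≡⟨ σ≗τ _ ⟨
    σ (inverse τ y) ∎)
    where open ≡.≡-Reasoning

  inverse-involutive : ∀ {σ} → IsBijection σ → inverse (inverse σ) ≗ σ
  inverse-involutive b x = proj₁ (inverse-isBijection b) _ _
    (≡.trans (inverse-section (proj₂ (inverse-isBijection b)) x) (≡.sym (inverse-retraction b x)))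

  toPermutation : ∀ {σ} → IsBijection σ → Permutation n n
  toPermutation {σ} b@(_ , surj) =
    permutation σ (inverse σ) (inverse-section surj) (inverse-retraction b)

injective⇒surjective : ∀ {n} {σ : Fin n → Fin n} → Injective σ → StrictlySurjective _≡_ σ
injective⇒surjective {zero}  inj ()
injective⇒surjective {suc n} {σ} inj y with Fin.any? (λ x → σ x ≟ y)
... | yes x = x
... | no ∄x = contradiction (Fin.injective⇒≤ punchOut∘σ-injective) ℕ.1+n≰n
  where
  missed : ∀ x → y ≢ σ x
  missed x y≡σx = ∄x (x , ≡.sym y≡σx)
  punchOut∘σ-injective : ∀ {i j} → punchOut (missed i) ≡ punchOut (missed j) → i ≡ j
  punchOut∘σ-injective eq = inj _ _ (Fin.punchOut-injective (missed _) (missed _) eq)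

collision : ∀ {n} {σ : Fin n → Fin n} → ¬ IsBijection σ → ∃₂ λ i j → i ≢ j × σ i ≡ σ j
collision {n} {σ} ¬bij
  with Fin.¬∀⟶∃¬ n _ (λ i → Fin.all? (λ j → (σ i ≟ σ j) →-dec (i ≟ j)))
         (λ inj → ¬bij (inj , injective⇒surjective inj))
... | i , ¬inj with Fin.¬∀⟶∃¬ n _ (λ j → (σ i ≟ σ j) →-dec (i ≟ j)) ¬inj
... | j , ¬σi≡σj⇒i≡j with σ i ≟ σ j
...   | yes σi≡σj = i , j , (λ i≡j → ¬σi≡σj⇒i≡j (λ _ → i≡j)) , σi≡σj
...   | no σi≢σj  = contradiction (λ σi≡σj → contradiction σi≡σj σi≢σj) ¬σi≡σj⇒i≡j

reflects-≡ : ∀ {a b} {A : Set a} {B : Set b} {x y} →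
  Reflects A x → Reflects B y → (A → B) → (B → A) → x ≡ y
reflects-≡ (ofʸ _)  (ofʸ _)  _ _ = ≡.refl
reflects-≡ (ofʸ a)  (ofⁿ ¬b) f _ = contradiction (f a) ¬b
reflects-≡ (ofⁿ ¬a) (ofʸ b)  _ g = contradiction (g b) ¬a
reflects-≡ (ofⁿ _)  (ofⁿ _)  _ _ = ≡.refl

isBijective-cong : ∀ {n} {σ τ : Fin n → Fin n} → σ ≗ τ → isBijective σ ≡ isBijective τ
isBijective-cong σ≗τ = reflects-≡ (isBijective-reflects _) (isBijective-reflects _)
  (isBijection-cong σ≗τ) (isBijection-cong (≡.sym ∘ σ≗τ))

isBijective-∘ʳ : ∀ {n} (σ : Fin n → Fin n) {τ} → IsBijection τ →
  isBijective (σ ∘ τ) ≡ isBijective σ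
isBijective-∘ʳ σ {τ} bτ@(_ , surj) =
  reflects-≡ (isBijective-reflects _) (isBijective-reflects _)
    (λ bστ → isBijection-cong (≡.cong σ ∘ inverse-section surj)
               (∘-isBijection bστ (inverse-isBijection bτ)))
    (λ bσ → ∘-isBijection bσ bτ)

-- Determinants sum over all endofunctions, so inversion is extended to non-bijections by the
-- identity, giving an involution of the whole function space to reindex by.
invertBijection : ∀ {n} → (Fin n → Fin n) → Fin n → Fin n
invertBijection σ = if isBijective σ then inverse σ else σ

invertBijection-yes : ∀ {n} {σ : Fin n → Fin n} → IsBijection σ → invertBijection σ ≡ inverse σ
invertBijection-yes {σ = σ} b rewrite Reflects.det (isBijective-reflects σ) (ofʸ b) = ≡.refl

invertBijection-no : ∀ {n} {σ : Fin n → Fin n} → ¬ IsBijection σ → invertBijection σ ≡ σ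
invertBijection-no {σ = σ} ¬b rewrite Reflects.det (isBijective-reflects σ) (ofⁿ ¬b) = ≡.refl

invertBijection-cong : ∀ {n} → invertBijection {n} Preserves _≗_ ⟶ _≗_
invertBijection-cong {x = σ} {σ′} σ≗σ′ k with isBijection? σ
... | yes b = ≡.trans (≡.cong-app (invertBijection-yes b) k) (≡.trans (inverse-cong b σ≗σ′ k)
    (≡.sym (≡.cong-app (invertBijection-yes (isBijection-cong σ≗σ′ b)) k)))
... | no ¬b = ≡.trans (≡.cong-app (invertBijection-no ¬b) k) (≡.trans (σ≗σ′ k)
    (≡.sym (≡.cong-app (invertBijection-no (¬b ∘ isBijection-cong (≡.sym ∘ σ≗σ′))) k)))

invertBijection-involutive : ∀ {n} (σ : Fin n → Fin n) → invertBijection (invertBijection σ) ≗ σ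
invertBijection-involutive σ k with isBijection? σ
... | yes b rewrite invertBijection-yes b =
  ≡.trans (≡.cong-app (invertBijection-yes (inverse-isBijection b)) k) (inverse-involutive b k)
... | no ¬b rewrite invertBijection-no ¬b | invertBijection-no ¬b = ≡.refl

module _ {n : ℕ} (i j : Fin n) where

  transpose-i : transpose i j i ≡ j
  transpose-i with i ≟ i
  ... | yes _  = ≡.refl
  ... | no i≢i = contradiction ≡.refl i≢i

  transpose-j : transpose i j j ≡ i
  transpose-j with j ≟ i
  ... | yes j≡i = j≡i
  ... | no _ with j ≟ j
  ...   | yes _  = ≡.refl
  ...   | no j≢j = contradiction ≡.refl j≢j

  transpose-other : ∀ {k} → k ≢ i → k ≢ j → transpose i j k ≡ k
  transpose-other {k} k≢i k≢j with k ≟ i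
  ... | yes k≡i = contradiction k≡i k≢i
  ... | no _ with k ≟ j
  ...   | yes k≡j = contradiction k≡j k≢j
  ...   | no _    = ≡.refl

  transpose-involutive : ∀ k → transpose i j (transpose i j k) ≡ k
  transpose-involutive k = by-cases (k ≟ i) (k ≟ j)
    where
    by-cases : Dec (k ≡ i) → Dec (k ≡ j) → transpose i j (transpose i j k) ≡ k
    by-cases (yes ≡.refl) _ = ≡.trans (≡.cong (transpose i j) transpose-i) transpose-j
    by-cases (no _) (yes ≡.refl) = ≡.trans (≡.cong (transpose i j) transpose-j) transpose-i
    by-cases (no k≢i) (no k≢j) =
      ≡.trans (≡.cong (transpose i j) (transpose-other k≢i k≢j)) (transpose-other k≢i k≢j)

  transpose-isBijection : IsBijection (transpose i j)
  transpose-isBijection =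
    isBijection-fromInverse (transpose i j) transpose-involutive transpose-involutive

finToFun-combine : ∀ {n k} (a : Fin n) (y : Fin (n ℕ.^ k)) →
  Fin.finToFun {n} {suc k} (Fin.combine a y) ≗ a ∷ Fin.finToFun y
finToFun-combine {n} {k} a y zero    = ≡.cong proj₁ (Fin.remQuot-combine {n} {n ℕ.^ k} a y)
finToFun-combine {n} {k} a y (suc i) =
  ≡.cong (λ y′ → Fin.finToFun y′ i) (≡.cong proj₂ (Fin.remQuot-combine {n} {n ℕ.^ k} a y))

funToFin-cong : ∀ {k n} {h h′ : Fin k → Fin n} → h ≗ h′ → Fin.funToFin h ≡ Fin.funToFin h′
funToFin-cong {zero}  _    = ≡.refl
funToFin-cong {suc k} h≗h′ = ≡.cong₂ Fin.combine (h≗h′ zero) (funToFin-cong (h≗h′ ∘ suc))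

_<ᵇ_ : ∀ {n} → Fin n → Fin n → Bool
a <ᵇ b = ⌊ a <? b ⌋

<ᵇ-asym : ∀ {n} {a b : Fin n} → a <ᵇ b ≡ true → b <ᵇ a ≡ false
<ᵇ-asym {a = a} {b} a<b with a <? b | b <? a
... | yes a<b | yes b<a = contradiction b<a (Fin.<-asym a<b)
... | _       | no _    = ≡.refl

<ᵇ⇒≢ : ∀ {n} {a b : Fin n} → a <ᵇ b ≡ true → a ≢ b
<ᵇ⇒≢ a<b ≡.refl with () ← ≡.trans (≡.sym a<b) (<ᵇ-asym a<b)

<ᵇ-asym-∧ : ∀ {n} (a b : Fin n) → a <ᵇ b ∧ b <ᵇ a ≡ false
<ᵇ-asym-∧ a b with a <ᵇ b in a<b
... | false = ≡.refl
... | true  = <ᵇ-asym a<b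

<ᵇ-flip : ∀ {n} {a b : Fin n} → a ≢ b → a <ᵇ b ≡ not (b <ᵇ a)
<ᵇ-flip {a = a} {b} a≢b with a <? b | b <? a
... | yes a<b | yes b<a = contradiction b<a (Fin.<-asym a<b)
... | yes _   | no _    = ≡.refl
... | no _    | yes _   = ≡.refl
... | no a≮b  | no b≮a  with Fin.<-cmp a b
...   | tri< a<b _ _ = contradiction a<b a≮b
...   | tri≈ _ a≡b _ = contradiction a≡b a≢b
...   | tri> _ _ b<a = contradiction b<a b≮a

module _ {c ℓ} (R : CommutativeRing c ℓ) where

  open CommutativeRing R hiding (zero)
  open RawMonoid +-rawMonoid using (sum)
  open RawMonoid *-rawMonoid using () renaming (sum to prod)
  open RingProperties ring using (-‿involutive; -‿distribˡ-*; -‿distribʳ-*)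
  open CommutativeSemigroupProperties *-commutativeSemigroup using (x∙yz≈y∙xz)
  open CommutativeMonoidSolver *-commutativeMonoid using (solve; _⊕_; _⊜_)
  open SetoidReasoning setoid
  module Sum = SemiringSum semiring
  module Prod = CommutativeMonoidSum *-commutativeMonoid
  open Sum using (sum-cong-≋; sum-replicate-zero; *-distribˡ-sum; *-distribʳ-sum)

  record IsLinear {T : Set} (L : (T → Carrier) → Carrier) : Set (c ⊔ ℓ) where
    field
      ∑-cong      : ∀ {f g} → (∀ t → f t ≈ g t) → L f ≈ L g
      ∑-distrib-+ : ∀ f g → L (λ t → f t + g t) ≈ L f + L g
      ∑-0         : L (λ _ → 0#) ≈ 0#
      *-distribˡ-∑ : ∀ x f → x * L f ≈ L (λ t → x * f t)

  open IsLinear public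

  sum-isLinear : ∀ n → IsLinear (sum {n})
  sum-isLinear n = record
    { ∑-cong       = sum-cong-≋
    ; ∑-distrib-+  = Sum.∑-distrib-+
    ; ∑-0          = sum-replicate-zero n
    ; *-distribˡ-∑ = *-distribˡ-sum
    }

  cons-isLinear : ∀ {A : Set} {k} {L : (A → Carrier) → Carrier} {L′ : ((Fin k → A) → Carrier) → Carrier} →
    IsLinear L → IsLinear L′ → IsLinear (λ f → L (λ a → L′ (λ h → f (a ∷ h))))
  cons-isLinear lin lin′ = record
    { ∑-cong       = λ f≈g → ∑-cong lin (λ a → ∑-cong lin′ (λ h → f≈g (a ∷ h)))
    ; ∑-distrib-+  = λ f g → trans (∑-cong lin (λ a → ∑-distrib-+ lin′ _ _)) (∑-distrib-+ lin _ _)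
    ; ∑-0          = trans (∑-cong lin (λ _ → ∑-0 lin′)) (∑-0 lin)
    ; *-distribˡ-∑ = λ x f → trans (*-distribˡ-∑ lin x _) (∑-cong lin (λ a → *-distribˡ-∑ lin′ x _))
    }

  sumFun-isLinear : ∀ {n} k → IsLinear (sumFun R {n} k)
  sumFun-isLinear zero    = record
    { ∑-cong = λ f≈g → f≈g _ ; ∑-distrib-+ = λ _ _ → refl ; ∑-0 = refl ; *-distribˡ-∑ = λ _ _ → refl }
  sumFun-isLinear (suc k) = cons-isLinear (sum-isLinear _) (sumFun-isLinear k)

  sumTuples-isLinear : ∀ {n} m → IsLinear (sumTuples R {n} m)
  sumTuples-isLinear zero    = record
    { ∑-cong = λ f≈g → f≈g _ ; ∑-distrib-+ = λ _ _ → refl ; ∑-0 = refl ; *-distribˡ-∑ = λ _ _ → refl }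
  sumTuples-isLinear (suc m) = cons-isLinear (sumFun-isLinear _) (sumTuples-isLinear m)

  sum-comm-linear : ∀ {T : Set} {L : (T → Carrier) → Carrier} → IsLinear L →
    ∀ n (X : Fin n → T → Carrier) → sum (λ j → L (X j)) ≈ L (λ t → sum (λ j → X j t))
  sum-comm-linear lin zero    X = sym (∑-0 lin)
  sum-comm-linear {L = L} lin (suc n) X = begin
    L (X zero) + sum (λ j → L (X (suc j)))            ≈⟨ +-congˡ (sum-comm-linear lin n (X ∘ suc)) ⟩
    L (X zero) + L (λ t → sum (λ j → X (suc j) t))    ≈⟨ ∑-distrib-+ lin _ _ ⟨
    L (λ t → X zero t + sum (λ j → X (suc j) t))      ∎

  sumFun-comm-linear : ∀ {T : Set} {L : (T → Carrier) → Carrier} → IsLinear L →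
    ∀ {n} k (X : (Fin k → Fin n) → T → Carrier) →
    sumFun R k (λ h → L (X h)) ≈ L (λ t → sumFun R k (λ h → X h t))
  sumFun-comm-linear lin zero    X = refl
  sumFun-comm-linear lin (suc k) X = trans
    (sum-cong-≋ (λ j → sumFun-comm-linear lin k (λ h → X (j ∷ h))))
    (sum-comm-linear lin _ (λ j t → sumFun R k (λ h → X (j ∷ h) t)))

  prod-of-sums : ∀ {n} k (X : Fin k → Fin n → Carrier) →
    prod (λ i → sum (X i)) ≈ sumFun R k (λ h → prod (λ i → X i (h i)))
  prod-of-sums zero        X = refl
  prod-of-sums {n} (suc k) X = begin
    sum (X zero) * prod (λ i → sum (X (suc i)))
      ≈⟨ *-congˡ (prod-of-sums k (X ∘ suc)) ⟩
    sum (X zero) * sumFun R k (λ h → prod (λ i → X (suc i) (h i)))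
      ≈⟨ *-distribʳ-sum _ (X zero) ⟩
    sum (λ j → X zero j * sumFun R k (λ h → prod (λ i → X (suc i) (h i))))
      ≈⟨ sum-cong-≋ {n} (λ j → *-distribˡ-∑ (sumFun-isLinear k) _ _) ⟩
    sumFun R (suc k) (λ h → prod (λ i → X i (h i))) ∎

  sum-combine : ∀ a b (f : Fin (a ℕ.* b) → Carrier) →
    sum f ≈ sum (λ i → sum (λ j → f (Fin.combine {a} {b} i j)))
  sum-combine zero    b f = refl
  sum-combine (suc a) b f = trans (sum-++ b (a ℕ.* b) f) (+-congˡ (sum-combine a b (f ∘ (b Fin.↑ʳ_))))
    where
    sum-++ : ∀ a b (f : Fin (a ℕ.+ b) → Carrier) →
      sum f ≈ sum (λ i → f (i Fin.↑ˡ b)) + sum (λ j → f (a Fin.↑ʳ j))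
    sum-++ zero    b f = sym (+-identityˡ _)
    sum-++ (suc a) b f = trans (+-congˡ (sum-++ a b (f ∘ suc))) (sym (+-assoc _ _ _))

  sumFun-as-sum : ∀ {n} k {f : (Fin k → Fin n) → Carrier} → f Preserves _≗_ ⟶ _≈_ →
    sumFun R k f ≈ sum (f ∘ Fin.finToFun)
  sumFun-as-sum zero        f-cong = sym (trans (+-identityʳ _) (f-cong (λ ())))
  sumFun-as-sum {n} (suc k) {f} f-cong = begin
    sum (λ a → sumFun R k (λ h → f (a ∷ h)))
      ≈⟨ sum-cong-≋ {n} (λ a → sumFun-as-sum k (λ h≗h′ → f-cong (∷-cong a h≗h′))) ⟩
    sum (λ a → sum (λ y → f (a ∷ Fin.finToFun {n} {k} y)))
      ≈⟨ sum-cong-≋ {n} (λ a → sum-cong-≋ {n ℕ.^ k} (λ y → f-cong (≡.sym ∘ finToFun-combine {n} {k} a y))) ⟩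
    sum (λ a → sum (λ y → f (Fin.finToFun {n} {suc k} (Fin.combine {n} {n ℕ.^ k} a y))))
      ≈⟨ sum-combine n (n ℕ.^ k) (f ∘ Fin.finToFun) ⟨
    sum (f ∘ Fin.finToFun) ∎
    where
    ∷-cong : ∀ a {h h′ : Fin k → Fin n} → h ≗ h′ → a ∷ h ≗ a ∷ h′
    ∷-cong a h≗h′ zero    = ≡.refl
    ∷-cong a h≗h′ (suc i) = h≗h′ i

  -- Transport to Fin (n ^ k), where sums are invariant under permutations.
  sumFun-reindex : ∀ {n} k {f : (Fin k → Fin n) → Carrier} → f Preserves _≗_ ⟶ _≈_ →
    ∀ {Φ Ψ} → Φ Preserves _≗_ ⟶ _≗_ → Ψ Preserves _≗_ ⟶ _≗_ →
    (∀ h → Φ (Ψ h) ≗ h) → (∀ h → Ψ (Φ h) ≗ h) →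
    sumFun R k f ≈ sumFun R k (f ∘ Φ)
  sumFun-reindex {n} k {f} f-cong {Φ} {Ψ} Φ-cong Ψ-cong ΦΨ ΨΦ = begin
    sumFun R k f                    ≈⟨ sumFun-as-sum k f-cong ⟩
    sum (f ∘ Fin.finToFun)          ≈⟨ Sum.sum-permute (f ∘ Fin.finToFun) π ⟩
    sum (f ∘ Fin.finToFun ∘ encode Φ) ≈⟨ sum-cong-≋ {n ℕ.^ k} (λ x → f-cong (Fin.finToFun-funToFin _)) ⟩
    sum (f ∘ Φ ∘ Fin.finToFun)      ≈⟨ sumFun-as-sum k (f-cong ∘ Φ-cong) ⟨
    sumFun R k (f ∘ Φ)              ∎
    where
    encode : ((Fin k → Fin n) → (Fin k → Fin n)) → Fin (n ℕ.^ k) → Fin (n ℕ.^ k)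
    encode Θ = Fin.funToFin ∘ Θ ∘ Fin.finToFun
    inverseOf : ∀ {Θ Θ′} → Θ Preserves _≗_ ⟶ _≗_ → (∀ h → Θ (Θ′ h) ≗ h) →
      ∀ x → encode Θ (encode Θ′ x) ≡ x
    inverseOf Θ-cong ΘΘ′ x = ≡.trans
      (funToFin-cong (λ i → ≡.trans (Θ-cong (Fin.finToFun-funToFin _) i) (ΘΘ′ _ i)))
      (Fin.funToFin-finToFin {k} {n} x)
    π : Permutation (n ℕ.^ k) (n ℕ.^ k)
    π = permutation (encode Φ) (encode Ψ) (inverseOf Φ-cong ΦΨ) (inverseOf Ψ-cong ΨΦ)

  _^ᵇ_ : Carrier → Bool → Carrier
  x ^ᵇ b = if b then x else 1#

  ^ᵇ-cong : ∀ b {x y} → x ≈ y → x ^ᵇ b ≈ y ^ᵇ b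
  ^ᵇ-cong true  x≈y = x≈y
  ^ᵇ-cong false _   = refl

  ^ᵇ-distrib-* : ∀ b x y → (x * y) ^ᵇ b ≈ x ^ᵇ b * y ^ᵇ b
  ^ᵇ-distrib-* true  x y = refl
  ^ᵇ-distrib-* false x y = sym (*-identityˡ 1#)

  ^ᵇ-split : ∀ u v w x → (u ≡ true → v ≡ not w) → x ^ᵇ u ≈ x ^ᵇ (u ∧ v) * x ^ᵇ (u ∧ w)
  ^ᵇ-split false v     w     x _ = sym (*-identityˡ 1#)
  ^ᵇ-split true  false true  x _ = sym (*-identityˡ x)
  ^ᵇ-split true  true  false x _ = sym (*-identityʳ x)
  ^ᵇ-split true  false false x v≡¬w with () ← v≡¬w ≡.refl
  ^ᵇ-split true  true  true  x v≡¬w with () ← v≡¬w ≡.refl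

  prod₂ : ∀ {n} → (Fin n → Fin n → Carrier) → Carrier
  prod₂ X = prod (λ i → prod (X i))

  prod₂-cong : ∀ {n} {X Y : Fin n → Fin n → Carrier} → (∀ i j → X i j ≈ Y i j) → prod₂ X ≈ prod₂ Y
  prod₂-cong {n} X≈Y = Prod.sum-cong-≋ {n} (λ i → Prod.sum-cong-≋ {n} (X≈Y i))

  prod₂-distrib-* : ∀ {n} (X Y : Fin n → Fin n → Carrier) →
    prod₂ (λ i j → X i j * Y i j) ≈ prod₂ X * prod₂ Y
  prod₂-distrib-* {n} X Y =
    trans (Prod.sum-cong-≋ {n} (λ i → Prod.∑-distrib-+ {n} (X i) (Y i))) (Prod.∑-distrib-+ {n} _ _)

  prod₂-transpose : ∀ {n} (X : Fin n → Fin n → Carrier) → prod₂ X ≈ prod₂ (λ i j → X j i)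
  prod₂-transpose = Prod.∑-comm

  prod₂-permute : ∀ {n} (X : Fin n → Fin n → Carrier) {π} → IsBijection π →
    prod₂ X ≈ prod₂ (λ i j → X (π i) (π j))
  prod₂-permute {n} X b = trans (Prod.sum-permute {n} _ (toPermutation b))
    (Prod.sum-cong-≋ {n} (λ i → Prod.sum-permute {n} _ (toPermutation b)))

  prodPairs : ∀ {n} → (Fin n → Fin n → Carrier) → Carrier
  prodPairs X = prod₂ (λ i j → X i j ^ᵇ (i <ᵇ j))

  -- The pairs i < j whose order π reverses are renamed (i, j) ↦ (j, i), which the symmetry
  -- of E allows; afterwards the pairs are counted by the order of (π i, π j).
  prodPairs-permute : ∀ {n} (E : Fin n → Fin n → Carrier) → (∀ a b → E a b ≈ E b a) →
    ∀ {π} → IsBijection π → prodPairs (λ i j → E (π i) (π j)) ≈ prodPairs E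
  prodPairs-permute {n} E E-sym {π} b@(inj , _) = begin
    prod₂ (λ i j → X i j ^ᵇ (i <ᵇ j))
      ≈⟨ prod₂-cong {n} (λ i j → ^ᵇ-split (i <ᵇ j) _ _ (X i j)
           (λ i<j → <ᵇ-flip (λ πi≡πj → <ᵇ⇒≢ i<j (inj _ _ πi≡πj)))) ⟩
    prod₂ (λ i j → X i j ^ᵇ (i <ᵇ j ∧ π i <ᵇ π j) * X i j ^ᵇ (i <ᵇ j ∧ π j <ᵇ π i))
      ≈⟨ prod₂-distrib-* {n} _ _ ⟩
    prod₂ (λ i j → X i j ^ᵇ (i <ᵇ j ∧ π i <ᵇ π j)) * prod₂ (λ i j → X i j ^ᵇ (i <ᵇ j ∧ π j <ᵇ π i))
      ≈⟨ *-congˡ (prod₂-transpose {n} _) ⟩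
    prod₂ (λ i j → X i j ^ᵇ (i <ᵇ j ∧ π i <ᵇ π j)) * prod₂ (λ i j → X j i ^ᵇ (j <ᵇ i ∧ π i <ᵇ π j))
      ≈⟨ *-cong (prod₂-cong {n} (λ i j → reflexive (≡.cong (X i j ^ᵇ_) (Bool.∧-comm (i <ᵇ j) _))))
                (prod₂-cong {n} (λ i j → trans (reflexive (≡.cong (X j i ^ᵇ_) (Bool.∧-comm (j <ᵇ i) _)))
                                           (^ᵇ-cong _ (E-sym _ _)))) ⟩
    prod₂ (λ i j → X i j ^ᵇ (π i <ᵇ π j ∧ i <ᵇ j)) * prod₂ (λ i j → X i j ^ᵇ (π i <ᵇ π j ∧ j <ᵇ i))
      ≈⟨ prod₂-distrib-* {n} _ _ ⟨
    prod₂ (λ i j → X i j ^ᵇ (π i <ᵇ π j ∧ i <ᵇ j) * X i j ^ᵇ (π i <ᵇ π j ∧ j <ᵇ i))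
      ≈⟨ prod₂-cong {n} (λ i j → ^ᵇ-split (π i <ᵇ π j) _ _ (X i j)
           (λ πi<πj → <ᵇ-flip (λ i≡j → <ᵇ⇒≢ πi<πj (≡.cong π i≡j)))) ⟨
    prod₂ (λ i j → E (π i) (π j) ^ᵇ (π i <ᵇ π j))
      ≈⟨ prod₂-permute (λ a b → E a b ^ᵇ (a <ᵇ b)) b ⟨
    prodPairs E ∎
    where
    X : Fin n → Fin n → Carrier
    X i j = E (π i) (π j)

  -x*-y≈x*y : ∀ x y → - x * - y ≈ x * y
  -x*-y≈x*y x y = trans (sym (-‿distribˡ-* x (- y)))
    (trans (-‿cong (sym (-‿distribʳ-* x y))) (-‿involutive _))

  ε : ∀ {n} → Fin n → Fin n → Carrier
  ε a b = (- 1#) ^ᵇ (b <ᵇ a)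

  ±1-square : ∀ b → (- 1#) ^ᵇ b * (- 1#) ^ᵇ b ≈ 1#
  ±1-square true  = trans (-x*-y≈x*y 1# 1#) (*-identityˡ 1#)
  ±1-square false = *-identityˡ 1#

  ε-square : ∀ {n} (a b : Fin n) → ε a b * ε a b ≈ 1#
  ε-square a b = ±1-square (b <ᵇ a)

  ε-antisym : ∀ {n} {a b : Fin n} → a ≢ b → ε b a ≈ - ε a b
  ε-antisym {a = a} {b} a≢b rewrite <ᵇ-flip a≢b with b <ᵇ a
  ... | true  = sym (-‿involutive 1#)
  ... | false = refl

  ε-upper : ∀ {n} (a b : Fin n) → ε a b ^ᵇ (a <ᵇ b) ≈ 1#
  ε-upper a b with a <ᵇ b in a<b
  ... | false = refl
  ... | true rewrite <ᵇ-asym a<b = refl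

  prod₂-1 : ∀ n → prod₂ {n} (λ _ _ → 1#) ≈ 1#
  prod₂-1 n = trans (Prod.sum-cong-≋ {n} (λ _ → Prod.sum-replicate-zero n)) (Prod.sum-replicate-zero n)

  sign-prodPairs : ∀ {n} (σ : Fin n → Fin n) → sign R σ ≈ prodPairs (λ i j → ε (σ i) (σ j))
  sign-prodPairs {n} σ = prod₂-cong {n} factor
    where
    factor : ∀ i j → (if i <ᵇ j ∧ σ j <ᵇ σ i then - 1# else 1#) ≈ ε (σ i) (σ j) ^ᵇ (i <ᵇ j)
    factor i j with i <ᵇ j
    ... | true  = refl
    ... | false = refl

  sign-cong : ∀ {n} {σ τ : Fin n → Fin n} → σ ≗ τ → sign R σ ≈ sign R τ
  sign-cong {n} {σ = σ} σ≗τ = prod₂-cong {n} (λ i j → reflexive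
    (≡.cong₂ (λ a b → if i <ᵇ j ∧ b <ᵇ a then - 1# else 1#) (σ≗τ i) (σ≗τ j)))

  sign-id : ∀ n → sign R {n} id ≈ 1#
  sign-id n = trans (sign-prodPairs {n} id) (trans (prod₂-cong {n} ε-upper) (prod₂-1 n))

  -- ε (σ a) (σ b) · ε a b is symmetric in a and b, and ε a b = 1 for a < b.
  sign-∘ : ∀ {n} {σ π : Fin n → Fin n} → IsBijection σ → IsBijection π →
    sign R (σ ∘ π) ≈ sign R σ * sign R π
  sign-∘ {n} {σ} {π} (σ-inj , _) bπ = begin
    sign R (σ ∘ π)
      ≈⟨ sign-prodPairs (σ ∘ π) ⟩
    prodPairs (λ i j → ε (σ (π i)) (σ (π j)))
      ≈⟨ prod₂-cong {n} (λ i j → ^ᵇ-cong (i <ᵇ j) (sym (trans (*-assoc _ _ _)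
           (trans (*-congˡ (ε-square (π i) (π j))) (*-identityʳ _))))) ⟩
    prodPairs (λ i j → E (π i) (π j) * ε (π i) (π j))
      ≈⟨ trans (prod₂-cong {n} (λ i j → ^ᵇ-distrib-* (i <ᵇ j) _ _)) (prod₂-distrib-* {n} _ _) ⟩
    prodPairs (λ i j → E (π i) (π j)) * prodPairs (λ i j → ε (π i) (π j))
      ≈⟨ *-cong (prodPairs-permute E E-sym bπ) (sym (sign-prodPairs π)) ⟩
    prodPairs E * sign R π
      ≈⟨ *-congʳ (prod₂-cong {n} (λ i j → trans (^ᵇ-distrib-* (i <ᵇ j) _ _)
           (trans (*-congˡ (ε-upper i j)) (*-identityʳ _)))) ⟩
    prodPairs (λ i j → ε (σ i) (σ j)) * sign R π
      ≈⟨ *-congʳ (sign-prodPairs σ) ⟨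
    sign R σ * sign R π ∎
    where
    E : Fin n → Fin n → Carrier
    E a b = ε (σ a) (σ b) * ε a b
    E-sym : ∀ a b → E a b ≈ E b a
    E-sym a b with a ≟ b
    ... | yes ≡.refl = refl
    ... | no a≢b = sym (trans (*-cong (ε-antisym (λ σa≡σb → a≢b (σ-inj a b σa≡σb))) (ε-antisym a≢b))
                              (-x*-y≈x*y _ _))

  sign-square : ∀ {n} (σ : Fin n → Fin n) → sign R σ * sign R σ ≈ 1#
  sign-square {n} σ = trans (sym (prod₂-distrib-* {n} _ _))
    (trans (prod₂-cong {n} (λ i j → ±1-square (i <ᵇ j ∧ σ j <ᵇ σ i))) (prod₂-1 n))

  sign-cancelʳ : ∀ {n} (ρ : Fin n → Fin n) {x y} → x * sign R ρ ≈ y * sign R ρ → x ≈ y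
  sign-cancelʳ ρ {x} {y} xρ≈yρ = begin
    x                          ≈⟨ *-identityʳ x ⟨
    x * 1#                     ≈⟨ *-congˡ (sign-square ρ) ⟨
    x * (sign R ρ * sign R ρ)  ≈⟨ *-assoc _ _ _ ⟨
    (x * sign R ρ) * sign R ρ  ≈⟨ *-congʳ xρ≈yρ ⟩
    (y * sign R ρ) * sign R ρ  ≈⟨ *-assoc _ _ _ ⟩
    y * (sign R ρ * sign R ρ)  ≈⟨ *-congˡ (sign-square ρ) ⟩
    y * 1#                     ≈⟨ *-identityʳ y ⟩
    y                          ∎

  sign-inverse : ∀ {n} {σ : Fin n → Fin n} → IsBijection σ → sign R (inverse σ) ≈ sign R σ
  sign-inverse {n} {σ} b = sign-cancelʳ σ (begin
    sign R (inverse σ) * sign R σ  ≈⟨ sign-∘ (inverse-isBijection b) b ⟨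
    sign R (inverse σ ∘ σ)         ≈⟨ sign-cong {n} (inverse-retraction b) ⟩
    sign R {n} id                  ≈⟨ sign-id n ⟩
    1#                             ≈⟨ sign-square σ ⟨
    sign R σ * sign R σ            ∎)

  sign-conjugate : ∀ {n} {ρ τ τ′ : Fin n → Fin n} →
    IsBijection ρ → IsBijection τ → IsBijection τ′ → τ′ ∘ ρ ≗ ρ ∘ τ → sign R τ′ ≈ sign R τ
  sign-conjugate {ρ = ρ} {τ} {τ′} bρ bτ bτ′ τ′ρ≗ρτ = sign-cancelʳ ρ (begin
    sign R τ′ * sign R ρ  ≈⟨ sign-∘ bτ′ bρ ⟨
    sign R (τ′ ∘ ρ)       ≈⟨ sign-cong τ′ρ≗ρτ ⟩
    sign R (ρ ∘ τ)        ≈⟨ sign-∘ bρ bτ ⟩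
    sign R ρ * sign R τ   ≈⟨ *-comm _ _ ⟩
    sign R τ * sign R ρ   ∎)

  -- Only the pair (0, 1) is an inversion; the other factors of rows 0 and 1 evaluate to 1#.
  sign-transpose₀₁ : ∀ n → sign R (transpose {suc (suc n)} zero (suc zero)) ≈ - 1#
  sign-transpose₀₁ n = begin
    sign R t                        ≈⟨ *-cong row₀ (*-cong row₁ (Prod.sum-cong-≋ {n} rowₖ)) ⟩
    - 1# * (1# * prod {n} (λ _ → 1#)) ≈⟨ *-congˡ (trans (*-identityˡ _) (Prod.sum-replicate-zero n)) ⟩
    - 1# * 1#                       ≈⟨ *-identityʳ _ ⟩
    - 1#                            ∎
    where
    t : Fin (suc (suc n)) → Fin (suc (suc n))
    t = transpose zero (suc zero)
    row : Fin (suc (suc n)) → Carrier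
    row i = prod (λ j → (- 1#) ^ᵇ (i <ᵇ j ∧ t j <ᵇ t i))
    row₀ : row zero ≈ - 1#
    row₀ = trans (*-identityˡ _) (trans (*-congˡ (Prod.sum-replicate-zero n)) (*-identityʳ _))
    row₁ : row (suc zero) ≈ 1#
    row₁ = trans (*-identityˡ _) (trans (*-identityˡ _) (Prod.sum-replicate-zero n))
    rowₖ : ∀ k → row (suc (suc k)) ≈ 1#
    rowₖ k = trans (*-identityˡ _) (trans (*-identityˡ _) (trans
      (Prod.sum-cong-≋ {n} (λ l → reflexive (≡.cong ((- 1#) ^ᵇ_) (<ᵇ-asym-∧ (suc (suc k)) (suc (suc l))))))
      (Prod.sum-replicate-zero n)))

  -- ρ sends 0 and 1 to i and j, which makes transpose i j a conjugate of transpose 0 1.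
  sign-transpose : ∀ {n} {i j : Fin n} → i ≢ j → sign R (transpose i j) ≈ - 1#
  sign-transpose {suc zero}    {zero} {zero} i≢j = contradiction ≡.refl i≢j
  sign-transpose {suc (suc n)} {i}    {j}    i≢j =
    trans (sign-conjugate bρ (transpose-isBijection zero (suc zero)) (transpose-isBijection i j) conj)
          (sign-transpose₀₁ n)
    where
    j′ : Fin (suc (suc n))
    j′ = transpose zero i j
    ρ : Fin (suc (suc n)) → Fin (suc (suc n))
    ρ = transpose zero i ∘ transpose (suc zero) j′
    bρ : IsBijection ρ
    bρ = ∘-isBijection (transpose-isBijection zero i) (transpose-isBijection (suc zero) j′)
    j′≢0 : j′ ≢ zero
    j′≢0 j′≡0 = i≢j (≡.trans (≡.sym (transpose-i zero i))
      (≡.trans (≡.cong (transpose zero i) (≡.sym j′≡0)) (transpose-involutive zero i j)))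
    ρ0≡i : ρ zero ≡ i
    ρ0≡i = ≡.trans (≡.cong (transpose zero i) (transpose-other (suc zero) j′ (λ ()) (j′≢0 ∘ ≡.sym)))
                   (transpose-i zero i)
    ρ1≡j : ρ (suc zero) ≡ j
    ρ1≡j = ≡.trans (≡.cong (transpose zero i) (transpose-i (suc zero) j′)) (transpose-involutive zero i j)
    conj : transpose i j ∘ ρ ≗ ρ ∘ transpose zero (suc zero)
    conj zero = ≡.trans (≡.cong (transpose i j) ρ0≡i) (≡.trans (transpose-i i j) (≡.sym ρ1≡j))
    conj (suc zero) = ≡.trans (≡.cong (transpose i j) ρ1≡j) (≡.trans (transpose-j i j) (≡.sym ρ0≡i))
    conj (suc (suc k)) = transpose-other i j
      (λ ρk≡i → 0≢2+k (proj₁ bρ _ _ (≡.trans ρ0≡i (≡.sym ρk≡i))))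
      (λ ρk≡j → 1≢2+k (proj₁ bρ _ _ (≡.trans ρ1≡j (≡.sym ρk≡j))))
      where
      0≢2+k : zero ≢ suc (suc k)
      0≢2+k ()
      1≢2+k : suc zero ≢ suc (suc k)
      1≢2+k ()

  𝟙-isBijective-cong : ∀ {n} (σ : Fin n → Fin n) {x y} → (IsBijection σ → x ≈ y) →
    𝟙 R (isBijective σ) * x ≈ 𝟙 R (isBijective σ) * y
  𝟙-isBijective-cong σ x≈y with isBijective σ | isBijective-reflects σ
  ... | true  | ofʸ b = *-congˡ (x≈y b)
  ... | false | ofⁿ _ = trans (zeroˡ _) (sym (zeroˡ _))

  𝟙-isBijective-true : ∀ {n} {σ : Fin n → Fin n} → IsBijection σ → ∀ x → 𝟙 R (isBijective σ) * x ≈ x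
  𝟙-isBijective-true {σ = σ} b x rewrite Reflects.det (isBijective-reflects σ) (ofʸ b) = *-identityˡ x

  𝟙-isBijective-false : ∀ {n} {σ : Fin n → Fin n} → ¬ IsBijection σ → ∀ x → 𝟙 R (isBijective σ) * x ≈ 0#
  𝟙-isBijective-false {σ = σ} ¬b x rewrite Reflects.det (isBijective-reflects σ) (ofⁿ ¬b) = zeroˡ x

  signedSum : ∀ {n} → ((Fin n → Fin n) → Carrier) → Carrier
  signedSum f = sumEndo R (λ σ → 𝟙 R (isBijective σ) * (sign R σ * f σ))

  signedSum-cong : ∀ {n} {f g : (Fin n → Fin n) → Carrier} →
    (∀ σ → IsBijection σ → f σ ≈ g σ) → signedSum f ≈ signedSum g
  signedSum-cong f≈g = ∑-cong (sumFun-isLinear _) (λ σ → 𝟙-isBijective-cong σ (*-congˡ ∘ f≈g σ))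

  signedSum-term-cong : ∀ {n} {f : (Fin n → Fin n) → Carrier} → f Preserves _≗_ ⟶ _≈_ →
    (λ σ → 𝟙 R (isBijective σ) * (sign R σ * f σ)) Preserves _≗_ ⟶ _≈_
  signedSum-term-cong f-cong σ≗τ =
    *-cong (reflexive (≡.cong (𝟙 R) (isBijective-cong σ≗τ))) (*-cong (sign-cong σ≗τ) (f-cong σ≗τ))

  signedSum-∘ʳ : ∀ {n} {f : (Fin n → Fin n) → Carrier} → f Preserves _≗_ ⟶ _≈_ →
    ∀ {τ} → IsBijection τ → signedSum f ≈ sign R τ * signedSum (λ σ → f (σ ∘ τ))
  signedSum-∘ʳ {n} {f} f-cong {τ} bτ@(_ , surj) = begin
    sumFun R n (λ σ → 𝟙 R (isBijective σ) * (sign R σ * f σ))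
      ≈⟨ sumFun-reindex n (signedSum-term-cong f-cong) (λ σ≗σ′ → σ≗σ′ ∘ τ) (λ σ≗σ′ → σ≗σ′ ∘ inverse τ)
           (λ σ → ≡.cong σ ∘ inverse-retraction bτ) (λ σ → ≡.cong σ ∘ inverse-section surj) ⟩
    sumFun R n (λ σ → 𝟙 R (isBijective (σ ∘ τ)) * (sign R (σ ∘ τ) * f (σ ∘ τ)))
      ≈⟨ ∑-cong (sumFun-isLinear n) term ⟩
    sumFun R n (λ σ → sign R τ * (𝟙 R (isBijective σ) * (sign R σ * f (σ ∘ τ))))
      ≈⟨ *-distribˡ-∑ (sumFun-isLinear n) _ _ ⟨
    sign R τ * signedSum (λ σ → f (σ ∘ τ)) ∎
    where
    term : ∀ σ → 𝟙 R (isBijective (σ ∘ τ)) * (sign R (σ ∘ τ) * f (σ ∘ τ)) ≈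
                 sign R τ * (𝟙 R (isBijective σ) * (sign R σ * f (σ ∘ τ)))
    term σ = begin
      𝟙 R (isBijective (σ ∘ τ)) * (sign R (σ ∘ τ) * f (σ ∘ τ))
        ≡⟨ ≡.cong (λ b → 𝟙 R b * (sign R (σ ∘ τ) * f (σ ∘ τ))) (isBijective-∘ʳ σ bτ) ⟩
      𝟙 R (isBijective σ) * (sign R (σ ∘ τ) * f (σ ∘ τ))
        ≈⟨ 𝟙-isBijective-cong σ (λ bσ → trans (*-congʳ (trans (sign-∘ bσ bτ) (*-comm _ _))) (*-assoc _ _ _)) ⟩
      𝟙 R (isBijective σ) * (sign R τ * (sign R σ * f (σ ∘ τ)))
        ≈⟨ x∙yz≈y∙xz _ _ _ ⟩
      sign R τ * (𝟙 R (isBijective σ) * (sign R σ * f (σ ∘ τ))) ∎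

  signedSum-inverse : ∀ {n} {f : (Fin n → Fin n) → Carrier} → f Preserves _≗_ ⟶ _≈_ →
    signedSum f ≈ signedSum (f ∘ inverse)
  signedSum-inverse {n} {f} f-cong = begin
    sumFun R n T
      ≈⟨ sumFun-reindex n (signedSum-term-cong f-cong) invertBijection-cong invertBijection-cong
           invertBijection-involutive invertBijection-involutive ⟩
    sumFun R n (T ∘ invertBijection)
      ≈⟨ ∑-cong (sumFun-isLinear n) term ⟩
    signedSum (f ∘ inverse) ∎
    where
    T : (Fin n → Fin n) → Carrier
    T σ = 𝟙 R (isBijective σ) * (sign R σ * f σ)
    term : ∀ σ → T (invertBijection σ) ≈ 𝟙 R (isBijective σ) * (sign R σ * f (inverse σ))
    term σ with isBijection? σ
    ... | yes b = begin
      T (invertBijection σ)              ≡⟨ ≡.cong T (invertBijection-yes b) ⟩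
      T (inverse σ)                      ≈⟨ 𝟙-isBijective-true (inverse-isBijection b) _ ⟩
      sign R (inverse σ) * f (inverse σ) ≈⟨ *-congʳ (sign-inverse b) ⟩
      sign R σ * f (inverse σ)           ≈⟨ 𝟙-isBijective-true b _ ⟨
      𝟙 R (isBijective σ) * (sign R σ * f (inverse σ)) ∎
    ... | no ¬b = begin
      T (invertBijection σ)  ≡⟨ ≡.cong T (invertBijection-no ¬b) ⟩
      T σ                    ≈⟨ 𝟙-isBijective-false ¬b _ ⟩
      0#                     ≈⟨ 𝟙-isBijective-false ¬b _ ⟨
      𝟙 R (isBijective σ) * (sign R σ * f (inverse σ)) ∎

  𝟙-split : ∀ b x → x ≈ 𝟙 R b * x + 𝟙 R (not b) * x
  𝟙-split true  x = sym (trans (+-congˡ (zeroˡ x)) (trans (+-identityʳ _) (*-identityˡ x)))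
  𝟙-split false x = sym (trans (+-congʳ (zeroˡ x)) (trans (+-identityˡ _) (*-identityˡ x)))

  -- σ and σ ∘ transpose i j contribute opposite terms.  Splitting by whether σ i < σ j
  -- counts each such pair once, without dividing by 2.
  signedSum-vanish : ∀ {n} {f : (Fin n → Fin n) → Carrier} → f Preserves _≗_ ⟶ _≈_ →
    ∀ {i j} → i ≢ j → (∀ σ → IsBijection σ → f (σ ∘ transpose i j) ≈ f σ) → signedSum f ≈ 0#
  signedSum-vanish {n} {f} f-cong {i} {j} i≢j f-invariant = begin
    sumFun R n T
      ≈⟨ ∑-cong lin (λ σ → 𝟙-split (ordered σ) (T σ)) ⟩
    sumFun R n (λ σ → 𝟙 R (ordered σ) * T σ + 𝟙 R (not (ordered σ)) * T σ)
      ≈⟨ ∑-distrib-+ lin _ _ ⟩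
    sumFun R n (λ σ → 𝟙 R (ordered σ) * T σ) + sumFun R n (λ σ → 𝟙 R (not (ordered σ)) * T σ)
      ≈⟨ +-congˡ (sumFun-reindex n lower-cong (λ σ≗σ′ → σ≗σ′ ∘ t) (λ σ≗σ′ → σ≗σ′ ∘ t)
           (λ σ → ≡.cong σ ∘ transpose-involutive i j) (λ σ → ≡.cong σ ∘ transpose-involutive i j)) ⟩
    sumFun R n (λ σ → 𝟙 R (ordered σ) * T σ) + sumFun R n (λ σ → 𝟙 R (not (ordered (σ ∘ t))) * T (σ ∘ t))
      ≈⟨ ∑-distrib-+ lin _ _ ⟨
    sumFun R n (λ σ → 𝟙 R (ordered σ) * T σ + 𝟙 R (not (ordered (σ ∘ t))) * T (σ ∘ t))
      ≈⟨ ∑-cong lin pair-cancels ⟩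
    sumFun R n (λ _ → 0#)
      ≈⟨ ∑-0 lin ⟩
    0# ∎
    where
    lin = sumFun-isLinear {n} n
    t = transpose i j
    T : (Fin n → Fin n) → Carrier
    T σ = 𝟙 R (isBijective σ) * (sign R σ * f σ)
    ordered : (Fin n → Fin n) → Bool
    ordered σ = σ i <ᵇ σ j
    lower-cong : (λ σ → 𝟙 R (not (ordered σ)) * T σ) Preserves _≗_ ⟶ _≈_
    lower-cong σ≗σ′ = *-cong (reflexive (≡.cong (𝟙 R ∘ not) (≡.cong₂ _<ᵇ_ (σ≗σ′ i) (σ≗σ′ j))))
                             (signedSum-term-cong f-cong σ≗σ′)
    pair-cancels : ∀ σ → 𝟙 R (ordered σ) * T σ + 𝟙 R (not (ordered (σ ∘ t))) * T (σ ∘ t) ≈ 0#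
    pair-cancels σ with isBijection? σ
    ... | no ¬b = trans (+-cong (trans (*-congˡ (𝟙-isBijective-false ¬b _)) (zeroʳ _))
                               (trans (*-congˡ (𝟙-isBijective-false (¬b ∘ σ∘t-bij⇒σ-bij) _)) (zeroʳ _)))
                        (+-identityʳ 0#)
      where
      σ∘t-bij⇒σ-bij : IsBijection (σ ∘ t) → IsBijection σ
      σ∘t-bij⇒σ-bij b = isBijection-cong (≡.cong σ ∘ transpose-involutive i j)
                          (∘-isBijection b (transpose-isBijection i j))
    ... | yes b@(inj , _) = begin
      𝟙 R (ordered σ) * T σ + 𝟙 R (not (ordered (σ ∘ t))) * T (σ ∘ t)
        ≡⟨ ≡.cong (λ u → 𝟙 R (ordered σ) * T σ + 𝟙 R u * T (σ ∘ t)) ordered-flips ⟩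
      𝟙 R (ordered σ) * T σ + 𝟙 R (ordered σ) * T (σ ∘ t)
        ≈⟨ distribˡ _ _ _ ⟨
      𝟙 R (ordered σ) * (T σ + T (σ ∘ t))
        ≈⟨ *-congˡ (+-congˡ T-flips) ⟩
      𝟙 R (ordered σ) * (T σ - T σ)
        ≈⟨ *-congˡ (-‿inverseʳ _) ⟩
      𝟙 R (ordered σ) * 0#
        ≈⟨ zeroʳ _ ⟩
      0# ∎
      where
      ordered-flips : not (ordered (σ ∘ t)) ≡ ordered σ
      ordered-flips = ≡.trans
        (≡.cong not (≡.trans (≡.cong₂ _<ᵇ_ (≡.cong σ (transpose-i i j)) (≡.cong σ (transpose-j i j)))
                             (<ᵇ-flip (λ σj≡σi → i≢j (inj _ _ (≡.sym σj≡σi))))))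
        (Bool.not-involutive _)
      T-flips : T (σ ∘ t) ≈ - T σ
      T-flips = begin
        𝟙 R (isBijective (σ ∘ t)) * (sign R (σ ∘ t) * f (σ ∘ t))
          ≈⟨ 𝟙-isBijective-true (∘-isBijection b (transpose-isBijection i j)) _ ⟩
        sign R (σ ∘ t) * f (σ ∘ t)
          ≈⟨ *-cong (sign-∘ b (transpose-isBijection i j)) (f-invariant σ b) ⟩
        (sign R σ * sign R t) * f σ
          ≈⟨ *-congʳ (*-congˡ (sign-transpose i≢j)) ⟩
        (sign R σ * - 1#) * f σ
          ≈⟨ *-congʳ (trans (-‿cong (sym (*-identityʳ _))) (-‿distribʳ-* _ _)) ⟨
        - sign R σ * f σ
          ≈⟨ -‿distribˡ-* _ _ ⟨
        - (sign R σ * f σ)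
          ≈⟨ -‿cong (𝟙-isBijective-true b _) ⟨
        - T σ ∎

  prodAlong : ∀ {n} → (Fin n → Fin n → Carrier) → (Fin n → Fin n) → Carrier
  prodAlong A σ = prod (λ i → A i (σ i))

  prodAlong-cong : ∀ {n} (A : Fin n → Fin n → Carrier) → prodAlong A Preserves _≗_ ⟶ _≈_
  prodAlong-cong {n} A σ≗τ = Prod.sum-cong-≋ {n} (λ i → reflexive (≡.cong (A i) (σ≗τ i)))

  prodAlong-permute : ∀ {n} (A : Fin n → Fin n → Carrier) σ {π} → IsBijection π →
    prodAlong A σ ≈ prod (λ i → A (π i) (σ (π i)))
  prodAlong-permute A σ b = Prod.sum-permute _ (toPermutation b)

  det-equal-rows : ∀ {n} (A : Fin n → Fin n → Carrier) {i j} → i ≢ j →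
    (∀ k → A i k ≈ A j k) → det R A ≈ 0#
  det-equal-rows {n} A {i} {j} i≢j Aᵢ≈Aⱼ = signedSum-vanish (prodAlong-cong A) i≢j (λ σ _ → begin
    prodAlong A (σ ∘ t)                   ≈⟨ prodAlong-permute A (σ ∘ t) (transpose-isBijection i j) ⟩
    prod (λ k → A (t k) (σ (t (t k))))    ≈⟨ Prod.sum-cong-≋ {n} (λ k → swap-rows k (σ (t (t k)))) ⟩
    prod (λ k → A k (σ (t (t k))))        ≈⟨ prodAlong-cong A (≡.cong σ ∘ transpose-involutive i j) ⟩
    prodAlong A σ                         ∎)
    where
    t = transpose i j
    swap-rows : ∀ k l → A (t k) l ≈ A k l
    swap-rows k l = by-cases (k ≟ i) (k ≟ j)
      where
      by-cases : Dec (k ≡ i) → Dec (k ≡ j) → A (t k) l ≈ A k l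
      by-cases (yes ≡.refl) _ = trans (reflexive (≡.cong (λ r → A r l) (transpose-i i j))) (sym (Aᵢ≈Aⱼ l))
      by-cases (no _) (yes ≡.refl) = trans (reflexive (≡.cong (λ r → A r l) (transpose-j i j))) (Aᵢ≈Aⱼ l)
      by-cases (no k≢i) (no k≢j) = reflexive (≡.cong (λ r → A r l) (transpose-other i j k≢i k≢j))

  det-permute-rows : ∀ {n} (A : Fin n → Fin n → Carrier) {h} → IsBijection h →
    det R (A ∘ h) ≈ sign R h * det R A
  det-permute-rows A {h} b = trans (signedSum-∘ʳ (prodAlong-cong (A ∘ h)) b)
    (*-congˡ (signedSum-cong (λ σ _ → sym (prodAlong-permute A σ b))))

  det-rows : ∀ {n} (A : Fin n → Fin n → Carrier) h →
    det R (A ∘ h) ≈ 𝟙 R (isBijective h) * (sign R h * det R A)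
  det-rows A h with isBijection? h
  ... | yes b = trans (det-permute-rows A b) (sym (𝟙-isBijective-true b _))
  ... | no ¬b with i , j , i≢j , hᵢ≡hⱼ ← collision ¬b =
    trans (det-equal-rows (A ∘ h) i≢j (λ k → reflexive (≡.cong (λ r → A r k) hᵢ≡hⱼ)))
          (sym (𝟙-isBijective-false ¬b _))

  det-transpose : ∀ {n} (A : Fin n → Fin n → Carrier) → det R (λ i j → A j i) ≈ det R A
  det-transpose A = begin
    signedSum (λ σ → prod (λ i → A (σ i) i))  ≈⟨ signedSum-cong along-inverse ⟨
    signedSum (prodAlong A ∘ inverse)          ≈⟨ signedSum-inverse (prodAlong-cong A) ⟨
    signedSum (prodAlong A)                    ∎
    where
    along-inverse : ∀ σ → IsBijection σ → prodAlong A (inverse σ) ≈ prod (λ i → A (σ i) i)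
    along-inverse σ b = trans (prodAlong-permute A (inverse σ) b)
      (Prod.sum-cong-≋ (λ i → reflexive (≡.cong (A (σ i)) (inverse-retraction b i))))

  det-* : ∀ {n} (A B : Fin n → Fin n → Carrier) →
    det R (λ i k → sum (λ j → A i j * B j k)) ≈ det R A * det R B
  det-* {n} A B = begin
    ∑σ (λ σ → 𝟙 R (isBijective σ) * (sign R σ * prod (λ i → sum (λ j → A i j * B j (σ i)))))
      ≈⟨ ∑-cong lin (λ σ → *-congˡ (*-congˡ (expand σ))) ⟩
    ∑σ (λ σ → 𝟙 R (isBijective σ) * (sign R σ * ∑h (λ h → prodAlong A h * prodAlong (B ∘ h) σ)))
      ≈⟨ ∑-cong lin (λ σ → trans (*-congˡ (*-distribˡ-∑ lin _ _)) (*-distribˡ-∑ lin _ _)) ⟩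
    ∑σ (λ σ → ∑h (λ h → 𝟙 R (isBijective σ) * (sign R σ * (prodAlong A h * prodAlong (B ∘ h) σ))))
      ≈⟨ ∑-cong lin (λ σ → ∑-cong lin (λ h → trans (*-congˡ (x∙yz≈y∙xz _ _ _)) (x∙yz≈y∙xz _ _ _))) ⟩
    ∑σ (λ σ → ∑h (λ h → prodAlong A h * (𝟙 R (isBijective σ) * (sign R σ * prodAlong (B ∘ h) σ))))
      ≈⟨ sumFun-comm-linear lin n _ ⟩
    ∑h (λ h → ∑σ (λ σ → prodAlong A h * (𝟙 R (isBijective σ) * (sign R σ * prodAlong (B ∘ h) σ))))
      ≈⟨ ∑-cong lin (λ h → *-distribˡ-∑ lin _ _) ⟨
    ∑h (λ h → prodAlong A h * det R (B ∘ h))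
      ≈⟨ ∑-cong lin (λ h → *-congˡ (det-rows B h)) ⟩
    ∑h (λ h → prodAlong A h * (𝟙 R (isBijective h) * (sign R h * det R B)))
      ≈⟨ ∑-cong lin (λ h → rearrange (prodAlong A h) (𝟙 R (isBijective h)) (sign R h) (det R B)) ⟩
    ∑h (λ h → det R B * (𝟙 R (isBijective h) * (sign R h * prodAlong A h)))
      ≈⟨ *-distribˡ-∑ lin _ _ ⟨
    det R B * det R A
      ≈⟨ *-comm _ _ ⟩
    det R A * det R B ∎
    where
    ∑σ ∑h : ((Fin n → Fin n) → Carrier) → Carrier
    ∑σ = sumFun R n
    ∑h = sumFun R n
    lin = sumFun-isLinear {n} n
    expand : ∀ σ → prod (λ i → sum (λ j → A i j * B j (σ i))) ≈
                   ∑h (λ h → prodAlong A h * prodAlong (B ∘ h) σ)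
    expand σ = trans (prod-of-sums n (λ i j → A i j * B j (σ i)))
                     (∑-cong lin (λ h → Prod.∑-distrib-+ {n} _ _))
    rearrange : ∀ p e s d → p * (e * (s * d)) ≈ d * (e * (s * p))
    rearrange p e s d = begin
      p * (e * (s * d))  ≈⟨ x∙yz≈y∙xz p e _ ⟩
      e * (p * (s * d))  ≈⟨ *-congˡ (trans (x∙yz≈y∙xz p s d) (*-congˡ (*-comm p d))) ⟩
      e * (s * (d * p))  ≈⟨ *-congˡ (x∙yz≈y∙xz s d p) ⟩
      e * (d * (s * p))  ≈⟨ x∙yz≈y∙xz e d _ ⟩
      d * (e * (s * p))  ∎

  det-cong : ∀ {n} {A B : Fin n → Fin n → Carrier} → (∀ i j → A i j ≈ B i j) → det R A ≈ det R B
  det-cong {n} A≈B = signedSum-cong (λ σ _ → Prod.sum-cong-≋ {n} (λ i → A≈B i (σ i)))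

  det-*ᵀ : ∀ {n} (g A : Fin n → Fin n → Carrier) →
    det R (λ i k → sum (λ j → g k j * A i j)) ≈ det R g * det R A
  det-*ᵀ {n} g A = begin
    det R (λ i k → sum (λ j → g k j * A i j))
      ≈⟨ det-cong {n} (λ i k → sum-cong-≋ {n} (λ j → *-comm (g k j) (A i j))) ⟩
    det R (λ i k → sum (λ j → A i j * g k j))  ≈⟨ det-* A (λ j k → g k j) ⟩
    det R A * det R (λ j k → g k j)            ≈⟨ *-congˡ (det-transpose g) ⟩
    det R A * det R g                          ≈⟨ *-comm _ _ ⟩
    det R g * det R A                          ∎

  slice : ∀ {n m} → Hypermatrix R n m → (Fin m → Fin n → Fin n) → Fin n → Fin n → Carrier
  slice M τ i j = M i j (λ l → τ l i)

  𝟙-∧ : ∀ a b → 𝟙 R (a ∧ b) ≈ 𝟙 R a * 𝟙 R b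
  𝟙-∧ true  b = sym (*-identityˡ _)
  𝟙-∧ false b = sym (zeroˡ _)

  DetF-as-sum-of-dets : ∀ {n} m (F : (Fin m → Fin n → Fin n) → Carrier) (M : Hypermatrix R n m) →
    DetF R F M ≈ sumTuples R m (λ τ → (𝟙 R (allBijective τ) * F τ) * det R (slice M τ))
  DetF-as-sum-of-dets {n} m F M = begin
    DetF R F M
      ≈⟨ ∑-cong (sumFun-isLinear n) (λ σ → ∑-cong (sumTuples-isLinear m) (λ τ → rearrange σ τ)) ⟩
    sumEndo R (λ σ → sumTuples R m (λ τ → C τ * term σ τ))
      ≈⟨ sumFun-comm-linear (sumTuples-isLinear m) n _ ⟩
    sumTuples R m (λ τ → sumEndo R (λ σ → C τ * term σ τ))
      ≈⟨ ∑-cong (sumTuples-isLinear m) (λ τ → *-distribˡ-∑ (sumFun-isLinear n) _ _) ⟨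
    sumTuples R m (λ τ → C τ * det R (slice M τ)) ∎
    where
    C : (Fin m → Fin n → Fin n) → Carrier
    C τ = 𝟙 R (allBijective τ) * F τ
    term : (Fin n → Fin n) → (Fin m → Fin n → Fin n) → Carrier
    term σ τ = 𝟙 R (isBijective σ) * (sign R σ * prodAlong (slice M τ) σ)
    rearrange : ∀ σ τ → 𝟙 R (isBijective σ ∧ allBijective τ) * (sign R σ * (F τ * prodAlong (slice M τ) σ))
                        ≈ C τ * term σ τ
    rearrange σ τ = trans (*-congʳ (𝟙-∧ (isBijective σ) (allBijective τ)))
      (solve 5 (λ a b s f q → (a ⊕ b) ⊕ (s ⊕ (f ⊕ q)) ⊜ (b ⊕ f) ⊕ (a ⊕ (s ⊕ q))) refl
        (𝟙 R (isBijective σ)) (𝟙 R (allBijective τ)) (sign R σ) (F τ) (prodAlong (slice M τ) σ))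

proposition1 : ∀ {c ℓ} (R : CommutativeRing c ℓ) (m n : ℕ)
    (F : (Fin m → Fin n → Fin n) → CommutativeRing.Carrier R)
    (g : Fin n → Fin n → CommutativeRing.Carrier R)
    (M : Hypermatrix R n m) →
    CommutativeRing._≈_ R (DetF R F (act R g M))
    (CommutativeRing._*_ R (det R g) (DetF R F M))
proposition1 R m n F g M = begin
  DetF R F (act R g M)
    ≈⟨ DetF-as-sum-of-dets R m F (act R g M) ⟩
  sumTuples R m (λ τ → C τ * det R (slice R (act R g M) τ))
    ≈⟨ ∑-cong (sumTuples-isLinear R m) (λ τ → *-congˡ (det-*ᵀ R g (slice R M τ))) ⟩
  sumTuples R m (λ τ → C τ * (det R g * det R (slice R M τ)))
    ≈⟨ ∑-cong (sumTuples-isLinear R m) (λ τ → x∙yz≈y∙xz _ _ _) ⟩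
  sumTuples R m (λ τ → det R g * (C τ * det R (slice R M τ)))
    ≈⟨ *-distribˡ-∑ (sumTuples-isLinear R m) _ _ ⟨
  det R g * sumTuples R m (λ τ → C τ * det R (slice R M τ))
    ≈⟨ *-congˡ (DetF-as-sum-of-dets R m F M) ⟨
  det R g * DetF R F M ∎
  where
  open CommutativeRing R
  open SetoidReasoning setoid
  open CommutativeSemigroupProperties *-commutativeSemigroup using (x∙yz≈y∙xz)
  C : (Fin m → Fin n → Fin n) → Carrier
  C τ = 𝟙 R (allBijective τ) * F τ
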